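{- For integers $\nu\ge1$ and $m\ge0$, as formal power series in $q$, \[ \sum_{n=0}^{\infty}N_\nu(n)q^n=\sum_{n=0}^{\infty}p(n)q^n\sum_{\tau=0}^{m}(-1)^\tau q^{(\nu+\tau)(\nu+\tau-1)/2}+(-1)^{m+1}\sum_{n=0}^{\infty}N_{\nu+m+1}(n)q^n. \]
   Context: $p(n)$ is the number of partitions of $n$. Definition of $N_\nu(n)$ (for $\nu\ge1$, $n\ge0$): for a partition $\lambda_1\ge\dots\ge\lambda_k$ of $n$, its $\nu$-Durfee rectangle is the largest rectangle of height $t$ and width $t+\nu$ fitting in its Young diagram, i.e. $t$ is the largest integer $0\le t\le k$ with $\lambda_t\ge t+\nu$ ($t=0$ always allowed). $N_\nu(n)$ is the number of partitions of $n$ such that each of $1,2,\dots,\nu-1$ occurs as a part at least once and every part below the $\nu$-Durfee rectangle is strictly less than its width, i.e. $\lambda_i<t+\nu$ for all $i>t$. -}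

module Defs where

open import Data.Nat using (ℕ; zero; suc; _+_; _*_; _∸_; _≤_; _<_; _⊔_; _≤?_; _<?_)
import Data.Nat as ℕ
open import Data.Nat.DivMod using (_/_)
open import Data.Integer as ℤ using (ℤ; +_; -_; _^_)
open import Data.List using (List; []; _∷_; length; map; concatMap; upTo; filter; drop; foldr)
open import Data.Nat.ListAction using (sum)
open import Data.List.Relation.Unary.All using (All; all?)
open import Data.List.Relation.Unary.Linked using (Linked; linked?)
open import Data.List.Membership.Propositional using (_∈_)
open import Data.List.Membership.DecPropositional ℕ._≟_ using (_∈?_)
open import Data.Product using (_×_)
open import Relation.Nullary using (Dec; yes; no)
open import Relation.Nullary.Decidable using (_×-dec_)
open import Relation.Binary.PropositionalEquality using (_≡_)

IsPartition : ℕ → List ℕ → Set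
IsPartition n λs = All (1 ≤_) λs × Linked ℕ._≥_ λs × sum λs ≡ n

isPartition? : (n : ℕ) (λs : List ℕ) → Dec (IsPartition n λs)
isPartition? n λs = all? (1 ≤?_) λs ×-dec (linked? ℕ._≥?_ λs ×-dec (sum λs ℕ.≟ n))

listsOfLength : ℕ → ℕ → List (List ℕ)
listsOfLength n zero    = [] ∷ []
listsOfLength n (suc k) =
  concatMap (λ x → map (x ∷_) (listsOfLength n k)) (map suc (upTo n))

-- a finite, duplicate-free superset of the partitions of n:
-- all lists of length ≤ n with entries in {1,…,n}
candidates : ℕ → List (List ℕ)
candidates n = concatMap (listsOfLength n) (upTo (suc n))

p : ℕ → ℕ
p n = length (filter (isPartition? n) (candidates n))

-- the t-th part λ_t (1-indexed); 0 if out of range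
part : List ℕ → ℕ → ℕ
part []       _             = 0
part (x ∷ xs) zero          = 0
part (x ∷ xs) (suc zero)    = x
part (x ∷ xs) (suc (suc i)) = part xs (suc i)

-- height t of the ν-Durfee rectangle: the largest t with 0 ≤ t ≤ k
-- (k = number of parts) such that λ_t ≥ t + ν  (t = 0 always allowed)
durfee : ℕ → List ℕ → ℕ
durfee ν λs =
  foldr _⊔_ 0 (filter (λ t → t + ν ≤? part λs t) (upTo (suc (length λs))))

-- the partition condition defining N_ν(n):
-- each of 1,…,ν-1 occurs as a part, and every part below the ν-Durfee
-- rectangle (i.e. λ_i with i > t) is < t + ν
NCond : ℕ → List ℕ → Set
NCond ν λs = All (_∈ λs) (map suc (upTo (ν ∸ 1)))
           × All (_< durfee ν λs + ν) (drop (durfee ν λs) λs)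

nCond? : (ν : ℕ) (λs : List ℕ) → Dec (NCond ν λs)
nCond? ν λs = all? (_∈? λs) (map suc (upTo (ν ∸ 1)))
           ×-dec all? (_<? durfee ν λs + ν) (drop (durfee ν λs) λs)

N : ℕ → ℕ → ℕ
N ν n = length (filter (λ λs → isPartition? n λs ×-dec nCond? ν λs) (candidates n))

-- Formal power series over ℤ in q, as coefficient sequences

FPS : Set
FPS = ℕ → ℤ

_+ₛ_ : FPS → FPS → FPS
(f +ₛ g) n = f n ℤ.+ g n

Σ≤ : ℕ → (ℕ → ℤ) → ℤ
Σ≤ zero    f = f 0
Σ≤ (suc n) f = Σ≤ n f ℤ.+ f (suc n)

_*ₛ_ : FPS → FPS → FPS
(f *ₛ g) n = Σ≤ n (λ i → f i ℤ.* g (n ∸ i))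

_·ₛ_ : ℤ → FPS → FPS
(c ·ₛ f) n = c ℤ.* f n

qPow : ℕ → FPS
qPow e n with e ℕ.≟ n
... | yes _ = + 1
... | no  _ = + 0

Σₛ : ℕ → (ℕ → FPS) → FPS
Σₛ m F n = Σ≤ m (λ τ → F τ n)

_≈ₛ_ : FPS → FPS → Set
f ≈ₛ g = ∀ n → f n ≡ g n

genP : FPS
genP n = + p n

genN : ℕ → FPS
genN ν n = + N ν n

tri : ℕ → ℕ
tri k = (k * (k ∸ 1)) / 2

{-# OPTIONS --safe #-}
-- Write T(ν) = ν(ν − 1)/2 and P(q) = Σ p(n) qⁿ. Deleting one copy of each of 1, …, ν − 1 is a
-- bijection onto the partitions of n − T(ν), so the partitions having every one of 1, …, ν − 1
-- as a part have generating function q^T(ν) P(q). Let t be the height of the ν-Durfee rectangle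
-- of such a partition. If every part below the rectangle is shorter than t + ν, the partition is
-- counted by N_ν. Otherwise the first part below the rectangle equals t + ν; deleting it, adding 1
-- to each of the t parts meeting the rectangle and inserting a part ν is a bijection onto the
-- partitions counted by N_{ν+1} (the (ν+1)-Durfee rectangle keeps height t). Hence
-- N_ν + N_{ν+1} = q^T(ν) P(q), and this recurrence at ν, ν + 1, …, ν + m telescopes to the identity.
module Submission where

open import Defs
open import Data.Nat using (ℕ; zero; suc; _+_; _*_; _∸_; _≤_; _<_; _≥_; z≤n; s≤s; _≤?_; _<?_; _⊔_)
import Data.Nat as ℕ
open import Data.Nat.Properties
open import Data.Nat.DivMod using (_/_; +-distrib-/-∣ʳ; m*n/n≡m)
open import Data.Nat.Divisibility using (divides-refl)
open import Data.Nat.Tactic.RingSolver using (solve-∀)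
open import Data.Nat.ListAction using (sum)
open import Data.Nat.ListAction.Properties using (sum-++)
open import Data.List using (List; []; _∷_; _++_; length; map; concatMap; upTo; filter; foldr; take; drop)
open import Data.List.Properties
  using (length-map; length-++; length-++-sucʳ; map-∘; map-id; map-id-local; filter-≐; filter-none; ∷-injectiveˡ; ∷-injectiveʳ)
open import Data.List.Relation.Unary.All as All using (All; []; _∷_)
import Data.List.Relation.Unary.All.Properties as All
open import Data.List.Relation.Unary.AllPairs as AllPairs using (AllPairs; []; _∷_)
import Data.List.Relation.Unary.AllPairs.Properties as AllPairs
open import Data.List.Relation.Unary.Linked using (Linked)
open import Data.List.Relation.Unary.Linked.Properties using (Linked⇒AllPairs; AllPairs⇒Linked)
open import Data.List.Relation.Unary.Any using (here; there)
open import Data.List.Relation.Unary.Unique.Propositional using (Unique)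
import Data.List.Relation.Unary.Unique.Propositional.Properties as Unique
open import Data.List.Relation.Binary.Subset.Propositional using (_⊆_)
open import Data.List.Relation.Binary.Disjoint.Propositional using (Disjoint)
open import Data.List.Membership.Propositional using (_∈_; find; lose)
open import Data.List.Membership.Propositional.Properties
  using (∈-∃++; ∈-++⁻; ∈-++⁺ˡ; ∈-++⁺ʳ; ∈-map⁻; ∈-map⁺; ∈-filter⁻; ∈-filter⁺; ∈-concatMap⁻; ∈-concatMap⁺;
         map∷⁻; ∈-upTo⁺; ∈-upTo⁻)
open import Data.Product using (_×_; _,_; proj₁; proj₂; ∃; ∃₂; assocʳ′; assocˡ′)
open import Function.Bundles using (_⇔_; mk⇔; module Equivalence)
open import Data.Sum using (inj₁; inj₂)
open import Relation.Nullary using (Dec; yes; no; ¬_; ¬?; contradiction)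
open import Relation.Nullary.Decidable using (_×-dec_)
open import Data.List.Membership.DecPropositional ℕ._≟_ using (_∈?_)
open import Function using (_∘_; flip; case_of_)
open import Relation.Unary using (Pred; Decidable)
open import Relation.Unary.Properties using (_∩?_; ∁?)
open import Relation.Binary.PropositionalEquality
open import Level using (0ℓ)
import Data.Integer as ℤ
import Data.Integer.Properties as ℤP
import Data.Integer.Tactic.RingSolver as ℤSolver
import Algebra.Properties.CommutativeSemigroup as CommutativeSemigroupProperties
open CommutativeSemigroupProperties +-commutativeSemigroup using (x∙yz≈y∙xz; xy∙z≈y∙xz)
open CommutativeSemigroupProperties ℤP.+-commutativeSemigroup using () renaming (interchange to ℤ+-interchange)
open CommutativeSemigroupProperties ℤP.*-commutativeSemigroup using () renaming (x∙yz≈y∙xz to ℤ*-x∙yz≈y∙xz)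
open import Data.Integer using (ℤ; 0ℤ; 1ℤ; +_; -_; _^_)

-- Counting via injections

module _ {A : Set} where

  Unique-⊆⇒length-≤ : ∀ {xs ys : List A} → Unique xs → xs ⊆ ys → length xs ≤ length ys
  Unique-⊆⇒length-≤ {[]} _ _ = z≤n
  Unique-⊆⇒length-≤ {x ∷ xs} (x∉xs ∷ xs!) xs⊆ys with ∈-∃++ (xs⊆ys (here refl))
  ... | as , bs , refl = begin
    suc (length xs)        ≤⟨ s≤s (Unique-⊆⇒length-≤ xs! xs⊆as++bs) ⟩
    suc (length (as ++ bs)) ≡⟨ length-++-sucʳ as x bs ⟨
    length (as ++ x ∷ bs)  ∎
    where
    open ≤-Reasoning
    xs⊆as++bs : xs ⊆ as ++ bs
    xs⊆as++bs y∈xs with ∈-++⁻ as (xs⊆ys (there y∈xs))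
    ... | inj₁ y∈as         = ∈-++⁺ˡ y∈as
    ... | inj₂ (here refl)  = contradiction refl (All.lookup x∉xs y∈xs)
    ... | inj₂ (there y∈bs) = ∈-++⁺ʳ as y∈bs

  module _ {P Q : Pred A 0ℓ} (P? : Decidable P) (Q? : Decidable Q) where

    length-filter-≤ : ∀ {xs ys} (f g : A → A) → Unique xs → (∀ {y} → Q y → y ∈ ys) →
                      (∀ {x} → P x → Q (f x)) → (∀ {x} → P x → g (f x) ≡ x) →
                      length (filter P? xs) ≤ length (filter Q? ys)
    length-filter-≤ {xs} {ys} f g xs! complete f-maps gf≡id = begin
      length ps          ≡⟨ length-map f ps ⟨
      length (map f ps)  ≤⟨ Unique-⊆⇒length-≤ fps! fps⊆ ⟩
      length (filter Q? ys) ∎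
      where
      open ≤-Reasoning
      ps = filter P? xs
      gfps≡ps : map g (map f ps) ≡ ps
      gfps≡ps = trans (sym (map-∘ ps)) (map-id-local (All.map gf≡id (All.all-filter P? xs)))
      fps! : Unique (map f ps)
      fps! = Unique.map⁻ (subst Unique (sym gfps≡ps) (Unique.filter⁺ P? xs!))
      fps⊆ : map f ps ⊆ filter Q? ys
      fps⊆ y∈fps with ∈-map⁻ f y∈fps
      ... | x , x∈ps , refl = let q = f-maps (proj₂ (∈-filter⁻ P? {xs = xs} x∈ps)) in ∈-filter⁺ Q? (complete q) q

    length-filter-split : ∀ xs → length (filter P? xs) ≡ length (filter (P? ∩? Q?) xs) + length (filter (P? ∩? ∁? Q?) xs)
    length-filter-split [] = refl
    length-filter-split (x ∷ xs) with P? x | Q? x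
    ... | yes _ | yes _ = cong suc (length-filter-split xs)
    ... | yes _ | no _  = trans (cong suc (length-filter-split xs)) (sym (+-suc _ _))
    ... | no _  | _     = length-filter-split xs

Unique-concatMap⁺ : ∀ {A B : Set} (h : A → List B) {ks} → Unique ks → (∀ k → Unique (h k)) →
                    (∀ {k k′} → k ≢ k′ → Disjoint (h k) (h k′)) → Unique (concatMap h ks)
Unique-concatMap⁺ h ks! h! disjoint =
  Unique.concat⁺ (All.map⁺ (All.universal h! _)) (AllPairs.map⁺ (AllPairs.map disjoint ks!))

listsOfLength-length : ∀ n k {ys} → ys ∈ listsOfLength n k → length ys ≡ k
listsOfLength-length n zero (here refl) = refl
listsOfLength-length n (suc k) ys∈ with find (∈-concatMap⁻ _ {xs = map suc (upTo n)} ys∈)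
... | x , _ , ys∈x∷ with map∷⁻ ys∈x∷
... | zs , zs∈ , refl = cong suc (listsOfLength-length n k zs∈)

listsOfLength-unique : ∀ n k → Unique (listsOfLength n k)
listsOfLength-unique n zero = [] ∷ []
listsOfLength-unique n (suc k) =
  Unique-concatMap⁺ _ (Unique.map⁺ suc-injective (Unique.upTo⁺ n))
    (λ x → Unique.map⁺ ∷-injectiveʳ (listsOfLength-unique n k)) heads-differ
  where
  heads-differ : ∀ {x x′} → x ≢ x′ → Disjoint (map (x ∷_) (listsOfLength n k)) (map (x′ ∷_) (listsOfLength n k))
  heads-differ x≢x′ (ys∈ , ys∈′) with map∷⁻ ys∈ | map∷⁻ ys∈′
  ... | _ , _ , refl | _ , _ , eq = x≢x′ (∷-injectiveˡ eq)

candidates-unique : ∀ n → Unique (candidates n)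
candidates-unique n = Unique-concatMap⁺ (listsOfLength n) (Unique.upTo⁺ (suc n)) (listsOfLength-unique n)
  (λ k≢k′ (ys∈ , ys∈′) → k≢k′ (trans (sym (listsOfLength-length n _ ys∈)) (listsOfLength-length n _ ys∈′)))

∈-listsOfLength : ∀ n xs → All (λ x → 1 ≤ x × x ≤ n) xs → xs ∈ listsOfLength n (length xs)
∈-listsOfLength n [] [] = here refl
∈-listsOfLength n (suc x ∷ xs) ((_ , x<n) ∷ xs-bounded) =
  ∈-concatMap⁺ (λ y → map (y ∷_) (listsOfLength n (length xs)))
    (lose (∈-map⁺ suc (∈-upTo⁺ x<n)) (∈-map⁺ (suc x ∷_) (∈-listsOfLength n xs xs-bounded)))

∈⇒≤-sum : ∀ {x xs} → x ∈ xs → x ≤ sum xs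
∈⇒≤-sum {xs = y ∷ ys} (here refl) = m≤m+n y (sum ys)
∈⇒≤-sum {xs = y ∷ ys} (there x∈ys) = ≤-trans (∈⇒≤-sum x∈ys) (m≤n+m (sum ys) y)

length≤sum : ∀ {xs} → All (1 ≤_) xs → length xs ≤ sum xs
length≤sum [] = z≤n
length≤sum (1≤x ∷ 1≤xs) = +-mono-≤ 1≤x (length≤sum 1≤xs)

IsPartition⇒∈-candidates : ∀ {n xs} → IsPartition n xs → xs ∈ candidates n
IsPartition⇒∈-candidates {xs = xs} (positive , _ , refl) =
  ∈-concatMap⁺ (listsOfLength (sum xs)) (lose (∈-upTo⁺ (s≤s (length≤sum positive)))
    (∈-listsOfLength (sum xs) xs (All.zip (positive , All.tabulate ∈⇒≤-sum))))

count : ℕ → {P : Pred (List ℕ) 0ℓ} → Decidable P → ℕ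
count n P? = length (filter P? (candidates n))

module _ {P Q : Pred (List ℕ) 0ℓ} (P? : Decidable P) (Q? : Decidable Q) where

  count-≡ : ∀ {n n′} (f g : List ℕ → List ℕ) →
            (∀ {x} → P x → IsPartition n x) → (∀ {y} → Q y → IsPartition n′ y) →
            (∀ {x} → P x → Q (f x)) → (∀ {y} → Q y → P (g y)) →
            (∀ {x} → P x → g (f x) ≡ x) → (∀ {y} → Q y → f (g y) ≡ y) →
            count n P? ≡ count n′ Q?
  count-≡ {n} {n′} f g P⇒partition Q⇒partition f-maps g-maps gf≡id fg≡id = ≤-antisym
    (length-filter-≤ P? Q? f g (candidates-unique n) (IsPartition⇒∈-candidates ∘ Q⇒partition) f-maps gf≡id)
    (length-filter-≤ Q? P? g f (candidates-unique n′) (IsPartition⇒∈-candidates ∘ P⇒partition) g-maps fg≡id)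

Descending : List ℕ → Set
Descending = AllPairs _≥_

Linked⇒Descending : ∀ {xs} → Linked _≥_ xs → Descending xs
Linked⇒Descending = Linked⇒AllPairs (flip ≤-trans)

take-length-++ : ∀ {A : Set} (xs : List A) {ys} → take (length xs) (xs ++ ys) ≡ xs
take-length-++ []       = refl
take-length-++ (x ∷ xs) = cong (x ∷_) (take-length-++ xs)

drop-length-++ : ∀ {A : Set} (xs : List A) {ys} → drop (length xs) (xs ++ ys) ≡ ys
drop-length-++ []       = refl
drop-length-++ (_ ∷ xs) = drop-length-++ xs

Descending-++ : ∀ {c xs ys} → Descending xs → Descending ys → All (c ≤_) xs → All (_≤ c) ys → Descending (xs ++ ys)
Descending-++ xs↓ ys↓ c≤xs ys≤c =
  AllPairs.++⁺ xs↓ ys↓ (All.map (λ c≤x → All.map (λ y≤c → ≤-trans y≤c c≤x) ys≤c) c≤xs)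

Descending-++⁻ : ∀ top {rest} → Descending (top ++ rest) → Descending top × Descending rest
Descending-++⁻ top ↓ = subst Descending (take-length-++ top) (AllPairs.take⁺ (length top) ↓)
                     , subst Descending (drop-length-++ top) (AllPairs.drop⁺ (length top) ↓)

∈-++-below : ∀ {c w} top {rest} → All (c ≤_) top → w < c → w ∈ top ++ rest → w ∈ rest
∈-++-below []        _              _   w∈           = w∈
∈-++-below (_ ∷ _)   (c≤x ∷ _)      w<c (here refl)  = contradiction c≤x (<⇒≱ w<c)
∈-++-below (_ ∷ top) (_ ∷ c≤top)    w<c (there w∈)   = ∈-++-below top c≤top w<c w∈

starts-with-bound : ∀ {c rest} → Descending rest → All (_≤ c) rest → ¬ All (_< c) rest → ∃ λ r → rest ≡ c ∷ r
starts-with-bound {rest = []}    _          _          ¬rest<c = contradiction [] ¬rest<c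
starts-with-bound {c} {y ∷ r}    (y≥r ∷ _)  (y≤c ∷ _)  ¬rest<c with y <? c
... | yes y<c = contradiction (y<c ∷ All.map (λ z≤y → ≤-<-trans z≤y y<c) y≥r) ¬rest<c
... | no y≮c  = r , cong (_∷ r) (≤-antisym y≤c (≮⇒≥ y≮c))

insert : ℕ → List ℕ → List ℕ
insert v [] = v ∷ []
insert v (x ∷ xs) with x ≤? v
... | yes _ = v ∷ x ∷ xs
... | no _  = x ∷ insert v xs

remove : ℕ → List ℕ → List ℕ
remove v [] = []
remove v (x ∷ xs) with x ℕ.≟ v
... | yes _ = xs
... | no _  = x ∷ remove v xs

module _ {P : ℕ → Set} {v : ℕ} where

  All-insert : ∀ {xs} → P v → All P xs → All P (insert v xs)
  All-insert pv [] = pv ∷ []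
  All-insert {x ∷ _} pv (px ∷ pxs) with x ≤? v
  ... | yes _ = pv ∷ px ∷ pxs
  ... | no _  = px ∷ All-insert pv pxs

  All-remove : ∀ {xs} → All P xs → All P (remove v xs)
  All-remove [] = []
  All-remove {x ∷ _} (px ∷ pxs) with x ℕ.≟ v
  ... | yes _ = pxs
  ... | no _  = px ∷ All-remove pxs

module _ (v : ℕ) where

  insert-descending : ∀ {xs} → Descending xs → Descending (insert v xs)
  insert-descending [] = [] ∷ []
  insert-descending {x ∷ _} (x≥xs ∷ xs↓) with x ≤? v
  ... | yes x≤v = (x≤v ∷ All.map (λ y≤x → ≤-trans y≤x x≤v) x≥xs) ∷ x≥xs ∷ xs↓
  ... | no x≰v  = All-insert (≰⇒≥ x≰v) x≥xs ∷ insert-descending xs↓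

  remove-descending : ∀ {xs} → Descending xs → Descending (remove v xs)
  remove-descending [] = []
  remove-descending {x ∷ _} (x≥xs ∷ xs↓) with x ℕ.≟ v
  ... | yes _ = xs↓
  ... | no _  = All-remove x≥xs ∷ remove-descending xs↓

  sum-insert : ∀ xs → sum (insert v xs) ≡ v + sum xs
  sum-insert [] = refl
  sum-insert (x ∷ xs) with x ≤? v
  ... | yes _ = refl
  ... | no _  = trans (cong (_+_ x) (sum-insert xs)) (x∙yz≈y∙xz x v (sum xs))

  sum-remove : ∀ {xs} → v ∈ xs → v + sum (remove v xs) ≡ sum xs
  sum-remove {x ∷ xs} v∈ with x ℕ.≟ v
  ... | yes refl = refl
  sum-remove {x ∷ xs} (here refl)  | no x≢v = contradiction refl x≢v
  sum-remove {x ∷ xs} (there v∈xs) | no _   = trans (x∙yz≈y∙xz v x _) (cong (_+_ x) (sum-remove v∈xs))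

  ∈-insert : ∀ xs → v ∈ insert v xs
  ∈-insert [] = here refl
  ∈-insert (x ∷ xs) with x ≤? v
  ... | yes _ = here refl
  ... | no _  = there (∈-insert xs)

  ∈-insert⁺ : ∀ {w xs} → w ∈ xs → w ∈ insert v xs
  ∈-insert⁺ {xs = x ∷ _} w∈ with x ≤? v
  ∈-insert⁺ w∈           | yes _ = there w∈
  ∈-insert⁺ (here w≡x)   | no _  = here w≡x
  ∈-insert⁺ (there w∈xs) | no _  = there (∈-insert⁺ w∈xs)

  ∈-remove⁺ : ∀ {w xs} → w ∈ xs → w ≢ v → w ∈ remove v xs
  ∈-remove⁺ {xs = x ∷ _} w∈ w≢v with x ℕ.≟ v
  ∈-remove⁺ (here refl)  w≢v | yes refl = contradiction refl w≢v
  ∈-remove⁺ (there w∈xs) w≢v | yes refl = w∈xs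
  ∈-remove⁺ (here w≡x)   w≢v | no _     = here w≡x
  ∈-remove⁺ (there w∈xs) w≢v | no _     = there (∈-remove⁺ w∈xs w≢v)

  remove-insert : ∀ xs → remove v (insert v xs) ≡ xs
  remove-insert [] with v ℕ.≟ v
  ... | yes _   = refl
  ... | no v≢v  = contradiction refl v≢v
  remove-insert (x ∷ xs) with x ≤? v
  ... | yes _ with v ℕ.≟ v
  ...   | yes _  = refl
  ...   | no v≢v = contradiction refl v≢v
  remove-insert (x ∷ xs) | no x≰v with x ℕ.≟ v
  ...   | yes refl = contradiction ≤-refl x≰v
  ...   | no _     = cong (x ∷_) (remove-insert xs)

  insert-remove : ∀ {xs} → Descending xs → v ∈ xs → insert v (remove v xs) ≡ xs
  insert-remove {x ∷ xs} (x≥xs ∷ xs↓) v∈ with x ℕ.≟ v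
  insert-remove {x ∷ []}    _           _ | yes refl = refl
  insert-remove {x ∷ y ∷ _} (x≥xs ∷ _)  _ | yes refl with y ≤? x
  ... | yes _   = refl
  ... | no y≰x  = contradiction (All.head x≥xs) y≰x
  insert-remove {x ∷ xs} _ (here refl) | no x≢v = contradiction refl x≢v
  insert-remove {x ∷ xs} (x≥xs ∷ xs↓) (there v∈xs) | no x≢v with x ≤? v
  ... | yes x≤v = contradiction (≤-antisym x≤v (All.lookup x≥xs v∈xs)) x≢v
  ... | no _    = cong (x ∷_) (insert-remove xs↓ v∈xs)

sum-map-suc : ∀ xs → sum (map suc xs) ≡ length xs + sum xs
sum-map-suc []       = refl
sum-map-suc (x ∷ xs) = cong suc (trans (cong (_+_ x) (sum-map-suc xs)) (x∙yz≈y∙xz x (length xs) (sum xs)))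

sum-map-pred : ∀ {xs} → All (1 ≤_) xs → length xs + sum (map ℕ.pred xs) ≡ sum xs
sum-map-pred []                       = refl
sum-map-pred {suc x ∷ xs} (_ ∷ 1≤xs) = cong suc (trans (x∙yz≈y∙xz (length xs) x _) (cong (_+_ x) (sum-map-pred 1≤xs)))

map-pred-suc : ∀ xs → map ℕ.pred (map suc xs) ≡ xs
map-pred-suc xs = trans (sym (map-∘ xs)) (map-id xs)

map-suc-pred : ∀ {xs} → All (1 ≤_) xs → map suc (map ℕ.pred xs) ≡ xs
map-suc-pred {xs} 1≤xs = trans (sym (map-∘ xs)) (map-id-local (All.map (λ { {suc _} _ → refl }) 1≤xs))

module _ {v : ℕ} where

  IsPartition-insert : ∀ {n xs} → 1 ≤ v → IsPartition n xs → IsPartition (v + n) (insert v xs)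
  IsPartition-insert {xs = xs} 1≤v (positive , descending , refl) =
    All-insert 1≤v positive , AllPairs⇒Linked (insert-descending v (Linked⇒Descending descending)) , sum-insert v xs

  IsPartition-remove : ∀ {n xs} → v ∈ xs → IsPartition (v + n) xs → IsPartition n (remove v xs)
  IsPartition-remove v∈ (positive , descending , sum≡) =
    All-remove positive , AllPairs⇒Linked (remove-descending v (Linked⇒Descending descending)) ,
    +-cancelˡ-≡ v _ _ (trans (sum-remove v v∈) sum≡)

-- The ν-Durfee rectangle

part-++ˡ : ∀ top rest {s} → 1 ≤ s → s ≤ length top → part (top ++ rest) s ∈ top
part-++ˡ (x ∷ top) rest {suc zero}    _ _         = here refl
part-++ˡ (x ∷ top) rest {suc (suc s)} _ (s≤s s<) = there (part-++ˡ top rest (s≤s z≤n) s<)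

part-≤ : ∀ {b xs} s → All (_≤ b) xs → part xs s ≤ b
part-≤ _             []         = z≤n
part-≤ zero          (_ ∷ _)    = z≤n
part-≤ (suc zero)    (x≤b ∷ _)  = x≤b
part-≤ (suc (suc s)) (_ ∷ xs≤b) = part-≤ (suc s) xs≤b

part-++ʳ : ∀ {b} top {rest s} → All (_≤ b) rest → length top < s → part (top ++ rest) s ≤ b
part-++ʳ []        {s = s} rest≤b _                   = part-≤ s rest≤b
part-++ʳ (_ ∷ top)         rest≤b (s≤s (s≤s top<s)) = part-++ʳ top rest≤b (s≤s top<s)

foldr-⊔-upper : ∀ {x xs} → x ∈ xs → x ≤ foldr _⊔_ 0 xs
foldr-⊔-upper {xs = y ∷ _} (here refl)  = m≤m⊔n y _
foldr-⊔-upper {xs = y ∷ _} (there x∈xs) = ≤-trans (foldr-⊔-upper x∈xs) (m≤n⊔m y _)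

foldr-⊔-least : ∀ {b xs} → All (_≤ b) xs → foldr _⊔_ 0 xs ≤ b
foldr-⊔-least []          = z≤n
foldr-⊔-least (x≤b ∷ xs≤b) = ⊔-lub x≤b (foldr-⊔-least xs≤b)

IsDurfeeSplit : ℕ → ℕ → List ℕ → List ℕ → Set
IsDurfeeSplit ν t top rest = length top ≡ t × All (t + ν ≤_) top × All (_≤ t + ν) rest

durfee-≥ : ∀ ν top rest → All (length top + ν ≤_) top → length top ≤ durfee ν (top ++ rest)
durfee-≥ ν []          rest _        = z≤n
durfee-≥ ν top@(_ ∷ _) rest top-tall =
  foldr-⊔-upper (∈-filter⁺ (λ s → s + ν ≤? part xs s) (∈-upTo⁺ (s≤s top≤xs))
                           (All.lookup top-tall (part-++ˡ top rest (s≤s z≤n) ≤-refl)))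
  where
  xs = top ++ rest
  top≤xs : length top ≤ length xs
  top≤xs = subst (length top ≤_) (sym (length-++ top)) (m≤m+n (length top) (length rest))

durfee-≤ : ∀ ν top {rest} → All (_≤ length top + ν) rest → durfee ν (top ++ rest) ≤ length top
durfee-≤ ν top {rest} rest-short = foldr-⊔-least (All.tabulate bounded)
  where
  xs = top ++ rest
  fits? = λ s → s + ν ≤? part xs s
  bounded : ∀ {s} → s ∈ filter fits? (upTo (suc (length xs))) → s ≤ length top
  bounded {s} s∈ with s ≤? length top
  ... | yes s≤t = s≤t
  ... | no s≰t  = contradiction (≤-trans (proj₂ (∈-filter⁻ fits? {xs = upTo (suc (length xs))} s∈))
                                         (part-++ʳ top rest-short (≰⇒> s≰t)))
                                (<⇒≱ (+-monoˡ-< ν (≰⇒> s≰t)))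

durfee-++ : ∀ ν {t top rest} → IsDurfeeSplit ν t top rest → durfee ν (top ++ rest) ≡ t
durfee-++ ν {top = top} {rest} (refl , top-tall , rest-short) = ≤-antisym (durfee-≤ ν top rest-short) (durfee-≥ ν top rest top-tall)

-- A part x > ν is a row of the ν-Durfee rectangle, whose remaining rows form the (ν + 1)-Durfee
-- rectangle of the later parts.
durfee-split : ∀ ν {xs} → Descending xs → ∃₂ λ top rest → xs ≡ top ++ rest × IsDurfeeSplit ν (length top) top rest
durfee-split ν {[]} [] = [] , [] , refl , refl , [] , []
durfee-split ν {x ∷ xs} (x≥xs ∷ xs↓) with suc ν ≤? x
... | no x≯ν = [] , x ∷ xs , refl , refl , [] , (x≤ν ∷ All.map (λ y≤x → ≤-trans y≤x x≤ν) x≥xs)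
  where x≤ν = ≤-pred (≰⇒> x≯ν)
... | yes x>ν with durfee-split (suc ν) xs↓
...   | top , rest , refl , refl , top-tall , rest-short =
  x ∷ top , rest , refl , refl ,
  (x-tall top top-tall x≥xs ∷ All.map (≤-trans (≤-reflexive (sym t+1+ν≡))) top-tall) ,
  All.map (λ y≤ → ≤-trans y≤ (≤-reflexive t+1+ν≡)) rest-short
  where
  t+1+ν≡ = +-suc (length top) ν
  x-tall : ∀ top′ → All (length top′ + suc ν ≤_) top′ → All (_≤ x) (top′ ++ rest) → suc (length top′ + ν) ≤ x
  x-tall []          _            _         = x>ν
  x-tall top′@(_ ∷ _) (y-tall ∷ _) (y≤x ∷ _) = ≤-trans (≤-reflexive (sym (+-suc (length top′) ν))) (≤-trans y-tall y≤x)

ShortBelowDurfee : ℕ → List ℕ → Set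
ShortBelowDurfee ν xs = All (_< durfee ν xs + ν) (drop (durfee ν xs) xs)

shortBelowDurfee? : ∀ ν xs → Dec (ShortBelowDurfee ν xs)
shortBelowDurfee? ν xs = All.all? (_<? durfee ν xs + ν) (drop (durfee ν xs) xs)

ShortBelowDurfee-++ : ∀ {ν t top rest} → IsDurfeeSplit ν t top rest → ShortBelowDurfee ν (top ++ rest) ⇔ All (_< t + ν) rest
ShortBelowDurfee-++ {ν} {t} {top} {rest} split@(refl , _) = mk⇔
  (subst (All _) (drop-length-++ top) ∘ subst At (durfee-++ ν split))
  (subst At (sym (durfee-++ ν split)) ∘ subst (All _) (sym (drop-length-++ top)))
  where
  At : ℕ → Set
  At s = All (_< s + ν) (drop s (top ++ rest))

-- Partitions having each of 1, …, ν − 1 as a part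

HasPartsUnder : ℕ → List ℕ → Set
HasPartsUnder ν xs = All (_∈ xs) (map suc (upTo (ν ∸ 1)))

hasPartsUnder? : ∀ ν xs → Dec (HasPartsUnder ν xs)
hasPartsUnder? ν xs = All.all? (_∈? xs) (map suc (upTo (ν ∸ 1)))

module _ {k : ℕ} {xs : List ℕ} where

  HasPartsUnder⇒∈ : HasPartsUnder (suc k) xs → ∀ {j} → j < k → suc j ∈ xs
  HasPartsUnder⇒∈ has j<k = All.lookup has (∈-map⁺ suc (∈-upTo⁺ j<k))

  ∈⇒HasPartsUnder : (∀ {j} → j < k → suc j ∈ xs) → HasPartsUnder (suc k) xs
  ∈⇒HasPartsUnder has = All.tabulate λ y∈ → case ∈-map⁻ suc y∈ of λ where
    (j , j∈ , refl) → has (∈-upTo⁻ j∈)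

withPartsUnder? : ∀ ν n xs → Dec (IsPartition n xs × HasPartsUnder ν xs)
withPartsUnder? ν n xs = isPartition? n xs ×-dec hasPartsUnder? ν xs

pWithPartsUnder : ℕ → ℕ → ℕ
pWithPartsUnder ν n = count n (withPartsUnder? ν n)

tri-suc : ∀ m → tri (suc m) ≡ tri m + m
tri-suc zero    = refl
tri-suc (suc j) = begin
  (2 + j) * (1 + j) / 2            ≡⟨ cong (_/ 2) (expand j) ⟩
  ((1 + j) * j + (1 + j) * 2) / 2  ≡⟨ +-distrib-/-∣ʳ ((1 + j) * j) (divides-refl (1 + j)) ⟩
  tri (1 + j) + (1 + j) * 2 / 2    ≡⟨ cong (_+_ (tri (1 + j))) (m*n/n≡m (1 + j) 2) ⟩
  tri (1 + j) + (1 + j)            ∎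
  where
  expand : ∀ j → (2 + j) * (1 + j) ≡ (1 + j) * j + (1 + j) * 2
  expand = solve-∀
  open ≡-Reasoning

pWithPartsUnder-suc : ∀ k n → pWithPartsUnder (suc (suc k)) (suc k + n) ≡ pWithPartsUnder (suc k) n
pWithPartsUnder-suc k n =
  count-≡ (withPartsUnder? (suc v) (v + n)) (withPartsUnder? v n) (remove v) (insert v) proj₁ proj₁ remove-maps insert-maps
  (λ (partition , has) → insert-remove v (Linked⇒Descending (proj₁ (proj₂ partition))) (has-v has))
  (λ _ → remove-insert v _)
  where
  v = suc k
  has-v : ∀ {xs} → HasPartsUnder (suc v) xs → v ∈ xs
  has-v has = HasPartsUnder⇒∈ has ≤-refl
  remove-maps : ∀ {xs} → IsPartition (v + n) xs × HasPartsUnder (suc v) xs →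
                IsPartition n (remove v xs) × HasPartsUnder v (remove v xs)
  remove-maps (partition , has) = IsPartition-remove (has-v has) partition ,
    ∈⇒HasPartsUnder (λ j<k → ∈-remove⁺ v (HasPartsUnder⇒∈ has (m<n⇒m<1+n j<k)) (<⇒≢ (s≤s j<k)))
  insert-maps : ∀ {xs} → IsPartition n xs × HasPartsUnder v xs →
                IsPartition (v + n) (insert v xs) × HasPartsUnder (suc v) (insert v xs)
  insert-maps {xs} (partition , has) = IsPartition-insert (s≤s z≤n) partition , ∈⇒HasPartsUnder has′
    where
    has′ : ∀ {j} → j < suc k → suc j ∈ insert v xs
    has′ {j} j≤k with m≤n⇒m<n∨m≡n (≤-pred j≤k)
    ... | inj₁ j<k  = ∈-insert⁺ v (HasPartsUnder⇒∈ has j<k)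
    ... | inj₂ refl = ∈-insert v xs

pWithPartsUnder-1 : ∀ n → pWithPartsUnder 1 n ≡ p n
pWithPartsUnder-1 n = cong length (filter-≐ (withPartsUnder? 1 n) (isPartition? n) (proj₁ , (_, [])) (candidates n))

pWithPartsUnder-small : ∀ k n → n < suc k → pWithPartsUnder (suc (suc k)) n ≡ 0
pWithPartsUnder-small k n n≤k = cong length (filter-none (withPartsUnder? (suc (suc k)) n) (All.universal too-big (candidates n)))
  where
  too-big : ∀ xs → ¬ (IsPartition n xs × HasPartsUnder (suc (suc k)) xs)
  too-big xs ((_ , _ , refl) , has) = <⇒≱ n≤k (∈⇒≤-sum (HasPartsUnder⇒∈ has ≤-refl))

pWithPartsUnder-tri+ : ∀ k n → pWithPartsUnder (suc k) (tri (suc k) + n) ≡ p n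
pWithPartsUnder-tri+ zero    n = pWithPartsUnder-1 n
pWithPartsUnder-tri+ (suc k) n = begin
  pWithPartsUnder (2 + k) (tri (2 + k) + n)             ≡⟨ cong (λ m → pWithPartsUnder (2 + k) (m + n)) (tri-suc (suc k)) ⟩
  pWithPartsUnder (2 + k) (tri (1 + k) + (1 + k) + n)   ≡⟨ cong (pWithPartsUnder (2 + k)) (xy∙z≈y∙xz (tri (1 + k)) (1 + k) n) ⟩
  pWithPartsUnder (2 + k) ((1 + k) + (tri (1 + k) + n)) ≡⟨ pWithPartsUnder-suc k (tri (1 + k) + n) ⟩
  pWithPartsUnder (1 + k) (tri (1 + k) + n)             ≡⟨ pWithPartsUnder-tri+ k n ⟩
  p n                                                   ∎
  where open ≡-Reasoning

pWithPartsUnder-<tri : ∀ k n → n < tri (suc k) → pWithPartsUnder (suc k) n ≡ 0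
pWithPartsUnder-<tri zero    n ()
pWithPartsUnder-<tri (suc k) n n<tri with n <? suc k
... | yes n≤k = pWithPartsUnder-small k n n≤k
... | no n≰k  = begin
  pWithPartsUnder (2 + k) n              ≡⟨ cong (pWithPartsUnder (2 + k)) (m+[n∸m]≡n (≮⇒≥ n≰k)) ⟨
  pWithPartsUnder (2 + k) ((1 + k) + n′) ≡⟨ pWithPartsUnder-suc k n′ ⟩
  pWithPartsUnder (1 + k) n′             ≡⟨ pWithPartsUnder-<tri k n′ n′<tri ⟩
  0                                      ∎
  where
  open ≡-Reasoning
  n′ = n ∸ suc k
  n′<tri : n′ < tri (suc k)
  n′<tri = subst (n′ <_) (m+n∸n≡m (tri (suc k)) (suc k))
                 (∸-monoˡ-< (subst (n <_) (tri-suc (suc k)) n<tri) (≮⇒≥ n≰k))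

-- The Durfee bijection

module DurfeeBijection (k : ℕ) where

  ν : ℕ
  ν = suc k

  LongBelowDurfee : ℕ → List ℕ → Set
  LongBelowDurfee n xs = (IsPartition n xs × HasPartsUnder ν xs) × ¬ ShortBelowDurfee ν xs

  longBelowDurfee? : ∀ n → Decidable (LongBelowDurfee n)
  longBelowDurfee? n xs = withPartsUnder? ν n xs ×-dec ¬? (shortBelowDurfee? ν xs)

  NPartition : ℕ → List ℕ → Set
  NPartition n ys = IsPartition n ys × NCond (suc ν) ys

  nPartition? : ∀ n → Decidable (NPartition n)
  nPartition? n ys = isPartition? n ys ×-dec nCond? (suc ν) ys

  raiseAt : ℕ → List ℕ → List ℕ
  raiseAt t xs = map suc (take t xs) ++ insert ν (drop (suc t) xs)

  lowerAt : ℕ → List ℕ → List ℕ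
  lowerAt t ys = map ℕ.pred (take t ys) ++ (t + ν) ∷ remove ν (drop t ys)

  raise : List ℕ → List ℕ
  raise xs = raiseAt (durfee ν xs) xs

  lower : List ℕ → List ℕ
  lower ys = lowerAt (durfee (suc ν) ys) ys

  raiseAt-++ : ∀ top {c r} → raiseAt (length top) (top ++ c ∷ r) ≡ map suc top ++ insert ν r
  raiseAt-++ []        = refl
  raiseAt-++ (x ∷ top) = cong (suc x ∷_) (raiseAt-++ top)

  raise-≡ : ∀ {t top r} → IsDurfeeSplit ν t top ((t + ν) ∷ r) → raise (top ++ (t + ν) ∷ r) ≡ map suc top ++ insert ν r
  raise-≡ {t} {top} {r} split@(refl , _) =
    trans (cong (λ s → raiseAt s (top ++ (t + ν) ∷ r)) (durfee-++ ν split)) (raiseAt-++ top)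

  lower-≡ : ∀ {t top rest} → IsDurfeeSplit (suc ν) t top rest → lower (top ++ rest) ≡ map ℕ.pred top ++ (t + ν) ∷ remove ν rest
  lower-≡ {top = top} {rest} split@(refl , _) = trans (cong (λ s → lowerAt s (top ++ rest)) (durfee-++ (suc ν) split))
    (cong₂ (λ a b → map ℕ.pred a ++ (length top + ν) ∷ remove ν b) (take-length-++ top) (drop-length-++ top))

  [a+b]+[c+d]≡b+[a+c+d] : ∀ a b c d → (a + b) + (c + d) ≡ b + ((a + c) + d)
  [a+b]+[c+d]≡b+[a+c+d] = solve-∀

  <-widen : ∀ {t y} → y ≤ t + ν → y < t + suc ν
  <-widen {t} y≤ = ≤-trans (s≤s y≤) (≤-reflexive (sym (+-suc t ν)))

  module Raise {top r : List ℕ} (top-tall : All (length top + ν ≤_) top) (r-short : All (_≤ length top + ν) r) where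

    t : ℕ
    t = length top

    split : IsDurfeeSplit ν t top ((t + ν) ∷ r)
    split = refl , top-tall , ≤-refl ∷ r-short

    raised : List ℕ
    raised = map suc top ++ insert ν r

    inserted-short : All (_< t + suc ν) (insert ν r)
    inserted-short = All-insert (<-widen (m≤n+m ν t)) (All.map <-widen r-short)

    raised-split : IsDurfeeSplit (suc ν) t (map suc top) (insert ν r)
    raised-split =
      length-map suc top , All.map⁺ (All.map (λ t+ν≤y → ≤-trans (≤-reflexive (+-suc t ν)) (s≤s t+ν≤y)) top-tall) ,
      All.map <⇒≤ inserted-short

    raised-short : ShortBelowDurfee (suc ν) raised
    raised-short = Equivalence.from (ShortBelowDurfee-++ raised-split) inserted-short

    lower-raised : lower raised ≡ top ++ (t + ν) ∷ r
    lower-raised = trans (lower-≡ raised-split) (cong₂ (λ a b → a ++ (t + ν) ∷ b) (map-pred-suc top) (remove-insert ν r))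

    raised-partition : ∀ {n} → IsPartition n (top ++ (t + ν) ∷ r) → IsPartition n raised
    raised-partition (positive , descending , refl) with Descending-++⁻ top (Linked⇒Descending descending)
    ... | top↓ , _ ∷ r↓ =
      All.++⁺ (All.map⁺ (All.universal (λ _ → s≤s z≤n) top)) (All-insert (s≤s z≤n) (All.tail (All.++⁻ʳ top positive))) ,
      AllPairs⇒Linked (Descending-++ (AllPairs.map⁺ (AllPairs.map s≤s top↓)) (insert-descending ν r↓)
                                     (All.map⁺ (All.map m≤n⇒m≤1+n top-tall)) (All-insert (m≤n+m ν t) r-short)) ,
      (begin
        sum (map suc top ++ insert ν r)        ≡⟨ sum-++ (map suc top) (insert ν r) ⟩
        sum (map suc top) + sum (insert ν r)   ≡⟨ cong₂ _+_ (sum-map-suc top) (sum-insert ν r) ⟩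
        (t + sum top) + (ν + sum r)            ≡⟨ [a+b]+[c+d]≡b+[a+c+d] t (sum top) ν (sum r) ⟩
        sum top + ((t + ν) + sum r)            ≡⟨ sum-++ top ((t + ν) ∷ r) ⟨
        sum (top ++ (t + ν) ∷ r)               ∎)
      where open ≡-Reasoning

    raised-hasParts : HasPartsUnder ν (top ++ (t + ν) ∷ r) → HasPartsUnder (suc ν) raised
    raised-hasParts has = ∈⇒HasPartsUnder has′
      where
      below-width : ∀ {j} → j < k → suc j < t + ν
      below-width j<k = ≤-trans (s≤s j<k) (m≤n+m ν t)
      ∈-r : ∀ {j} → j < k → suc j ∈ r
      ∈-r j<k with ∈-++-below top top-tall (below-width j<k) (HasPartsUnder⇒∈ has j<k)
      ... | here j+1≡t+ν = contradiction j+1≡t+ν (<⇒≢ (below-width j<k))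
      ... | there j+1∈r  = j+1∈r
      has′ : ∀ {j} → j < ν → suc j ∈ raised
      has′ j≤k with m≤n⇒m<n∨m≡n (≤-pred j≤k)
      ... | inj₁ j<k  = ∈-++⁺ʳ (map suc top) (∈-insert⁺ ν (∈-r j<k))
      ... | inj₂ refl = ∈-++⁺ʳ (map suc top) (∈-insert ν r)

  module Lower {top rest : List ℕ} (top-tall : All (length top + suc ν ≤_) top) (rest-short : All (_≤ length top + ν) rest) where

    t : ℕ
    t = length top

    split : IsDurfeeSplit (suc ν) t top rest
    split = refl , top-tall , All.map (<⇒≤ ∘ <-widen) rest-short

    lowered : List ℕ
    lowered = map ℕ.pred top ++ (t + ν) ∷ remove ν rest

    lowered-top-tall : All (t + ν ≤_) (map ℕ.pred top)
    lowered-top-tall = All.map⁺ (All.map (λ le → pred-mono-≤ (≤-trans (≤-reflexive (sym (+-suc t ν))) le)) top-tall)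

    lowered-split : IsDurfeeSplit ν t (map ℕ.pred top) ((t + ν) ∷ remove ν rest)
    lowered-split = length-map ℕ.pred top , lowered-top-tall , ≤-refl ∷ All-remove rest-short

    lowered-long : ¬ ShortBelowDurfee ν lowered
    lowered-long short = <-irrefl refl (All.head (Equivalence.to (ShortBelowDurfee-++ lowered-split) short))

    ν∈rest : HasPartsUnder (suc ν) (top ++ rest) → ν ∈ rest
    ν∈rest has = ∈-++-below top top-tall (<-widen (m≤n+m ν t)) (HasPartsUnder⇒∈ has ≤-refl)

    raise-lowered : ∀ {n} → IsPartition n (top ++ rest) → ν ∈ rest → raise lowered ≡ top ++ rest
    raise-lowered (positive , descending , _) ν∈ =
      trans (raise-≡ lowered-split)
            (cong₂ _++_ (map-suc-pred (All.++⁻ˡ top positive))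
                        (insert-remove ν (proj₂ (Descending-++⁻ top (Linked⇒Descending descending))) ν∈))

    lowered-partition : ∀ {n} → ν ∈ rest → IsPartition n (top ++ rest) → IsPartition n lowered
    lowered-partition ν∈ (positive , descending , refl) with Descending-++⁻ top (Linked⇒Descending descending)
    ... | top↓ , rest↓ =
      All.++⁺ (All.map (≤-trans 1≤t+ν) lowered-top-tall) (1≤t+ν ∷ All-remove (All.++⁻ʳ top positive)) ,
      AllPairs⇒Linked (Descending-++ (AllPairs.map⁺ (AllPairs.map pred-mono-≤ top↓))
                                     (All-remove rest-short ∷ remove-descending ν rest↓)
                                     lowered-top-tall (≤-refl ∷ All-remove rest-short)) ,
      (begin
        sum (map ℕ.pred top ++ (t + ν) ∷ remove ν rest)               ≡⟨ sum-++ (map ℕ.pred top) _ ⟩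
        sum (map ℕ.pred top) + ((t + ν) + sum (remove ν rest))         ≡⟨ [a+b]+[c+d]≡b+[a+c+d] t _ ν _ ⟨
        (t + sum (map ℕ.pred top)) + (ν + sum (remove ν rest))         ≡⟨ cong₂ _+_ (sum-map-pred (All.++⁻ˡ top positive)) (sum-remove ν ν∈) ⟩
        sum top + sum rest                                             ≡⟨ sum-++ top rest ⟨
        sum (top ++ rest)                                              ∎)
      where
      open ≡-Reasoning
      1≤t+ν : 1 ≤ t + ν
      1≤t+ν = ≤-trans (s≤s z≤n) (m≤n+m ν t)

    lowered-hasParts : HasPartsUnder (suc ν) (top ++ rest) → HasPartsUnder ν lowered
    lowered-hasParts has = ∈⇒HasPartsUnder λ j<k →
      ∈-++⁺ʳ (map ℕ.pred top) (there (∈-remove⁺ ν (∈-rest j<k) (<⇒≢ (s≤s j<k))))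
      where
      ∈-rest : ∀ {j} → j < k → suc j ∈ rest
      ∈-rest j<k = ∈-++-below top top-tall (<-widen (≤-trans (m≤n⇒m≤1+n j<k) (m≤n+m ν t)))
                     (HasPartsUnder⇒∈ has (m<n⇒m<1+n j<k))

  longBelowDurfee-shape : ∀ {n xs} → LongBelowDurfee n xs →
    ∃₂ λ top r → xs ≡ top ++ (length top + ν) ∷ r × All (length top + ν ≤_) top × All (_≤ length top + ν) r
  longBelowDurfee-shape (((_ , descending , _) , _) , long) with durfee-split ν (Linked⇒Descending descending)
  ... | top , rest , refl , split@(_ , top-tall , rest-short)
    with starts-with-bound (proj₂ (Descending-++⁻ top (Linked⇒Descending descending))) rest-short
                           (long ∘ Equivalence.from (ShortBelowDurfee-++ split))
  ...   | r , refl = top , r , refl , top-tall , All.tail rest-short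

  nPartition-shape : ∀ {n ys} → NPartition n ys →
    ∃₂ λ top rest → ys ≡ top ++ rest × All (length top + suc ν ≤_) top × All (_≤ length top + ν) rest
  nPartition-shape ((_ , descending , _) , _ , short) with durfee-split (suc ν) (Linked⇒Descending descending)
  ... | top , rest , refl , split@(_ , top-tall , _) =
    top , rest , refl , top-tall ,
    All.map (λ y< → ≤-pred (≤-trans y< (≤-reflexive (+-suc (length top) ν)))) (Equivalence.to (ShortBelowDurfee-++ split) short)

  count-longBelowDurfee : ∀ n → count n (longBelowDurfee? n) ≡ N (suc ν) n
  count-longBelowDurfee n = count-≡ (longBelowDurfee? n) (nPartition? n) raise lower (proj₁ ∘ proj₁) proj₁
                        raise-maps lower-maps lower-raise raise-lower
    where
    raise-maps : ∀ {xs} → LongBelowDurfee n xs → NPartition n (raise xs)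
    raise-maps l with longBelowDurfee-shape l
    raise-maps ((partition , has) , _) | top , r , refl , top-tall , r-short =
      subst (NPartition n) (sym (raise-≡ split)) (raised-partition partition , raised-hasParts has , raised-short)
      where open Raise top-tall r-short
    lower-raise : ∀ {xs} → LongBelowDurfee n xs → lower (raise xs) ≡ xs
    lower-raise l with longBelowDurfee-shape l
    ... | top , r , refl , top-tall , r-short = trans (cong lower (raise-≡ split)) lower-raised
      where open Raise top-tall r-short
    lower-maps : ∀ {ys} → NPartition n ys → LongBelowDurfee n (lower ys)
    lower-maps q with nPartition-shape q
    lower-maps (partition , has , _) | top , rest , refl , top-tall , rest-short =
      subst (LongBelowDurfee n) (sym (lower-≡ split))
        ((lowered-partition (ν∈rest has) partition , lowered-hasParts has) , lowered-long)
      where open Lower top-tall rest-short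
    raise-lower : ∀ {ys} → NPartition n ys → raise (lower ys) ≡ ys
    raise-lower q with nPartition-shape q
    raise-lower (partition , has , _) | top , rest , refl , top-tall , rest-short =
      trans (cong raise (lower-≡ split)) (raise-lowered partition (ν∈rest has))
      where open Lower top-tall rest-short

N+N≡pWithPartsUnder : ∀ k n → N (suc k) n + N (suc (suc k)) n ≡ pWithPartsUnder (suc k) n
N+N≡pWithPartsUnder k n = begin
  N ν n + N (suc ν) n                                         ≡⟨ cong₂ _+_ count-short (count-longBelowDurfee n) ⟨
  count n (withPartsUnder? ν n ∩? short?) + count n (longBelowDurfee? n)
                                                              ≡⟨ length-filter-split (withPartsUnder? ν n) short? (candidates n) ⟨
  pWithPartsUnder ν n                                         ∎
  where
  open DurfeeBijection k
  open ≡-Reasoning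
  short? = shortBelowDurfee? ν
  count-short : count n (withPartsUnder? ν n ∩? short?) ≡ N ν n
  count-short = cong length (filter-≐ (withPartsUnder? ν n ∩? short?) (λ xs → isPartition? n xs ×-dec nCond? ν xs)
                                      (assocʳ′ , assocˡ′) (candidates n))

-- Formal power series

Σ≤-cong : ∀ n {f g : ℕ → ℤ} → (∀ {i} → i ≤ n → f i ≡ g i) → Σ≤ n f ≡ Σ≤ n g
Σ≤-cong zero    f≗g = f≗g z≤n
Σ≤-cong (suc n) f≗g = cong₂ ℤ._+_ (Σ≤-cong n (f≗g ∘ m≤n⇒m≤1+n)) (f≗g ≤-refl)

Σ≤-+ : ∀ n (f g : ℕ → ℤ) → Σ≤ n (λ i → f i ℤ.+ g i) ≡ Σ≤ n f ℤ.+ Σ≤ n g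
Σ≤-+ zero    f g = refl
Σ≤-+ (suc n) f g = trans (cong (ℤ._+ (f (suc n) ℤ.+ g (suc n))) (Σ≤-+ n f g))
                         (ℤ+-interchange (Σ≤ n f) (Σ≤ n g) (f (suc n)) (g (suc n)))

Σ≤-* : ∀ n c (f : ℕ → ℤ) → Σ≤ n (λ i → c ℤ.* f i) ≡ c ℤ.* Σ≤ n f
Σ≤-* zero    c f = refl
Σ≤-* (suc n) c f = trans (cong (ℤ._+ c ℤ.* f (suc n)) (Σ≤-* n c f)) (sym (ℤP.*-distribˡ-+ c (Σ≤ n f) (f (suc n))))

Σ≤-vanishing : ∀ n {f : ℕ → ℤ} → (∀ {i} → i ≤ n → f i ≡ 0ℤ) → Σ≤ n f ≡ 0ℤ
Σ≤-vanishing zero    f≡0 = f≡0 z≤n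
Σ≤-vanishing (suc n) f≡0 = cong₂ ℤ._+_ (Σ≤-vanishing n (f≡0 ∘ m≤n⇒m≤1+n)) (f≡0 ≤-refl)

Σ≤-single : ∀ n {j} {f : ℕ → ℤ} → j ≤ n → (∀ {i} → i ≤ n → i ≢ j → f i ≡ 0ℤ) → Σ≤ n f ≡ f j
Σ≤-single zero    z≤n f≡0 = refl
Σ≤-single (suc n) {j} {f} j≤1+n f≡0 with j ℕ.≟ suc n
... | yes refl = trans (cong (ℤ._+ f (suc n)) (Σ≤-vanishing n λ i≤n → f≡0 (m≤n⇒m≤1+n i≤n) (<⇒≢ (s≤s i≤n))))
                       (ℤP.+-identityˡ (f (suc n)))
... | no j≢1+n = trans (cong₂ ℤ._+_ (Σ≤-single n (≤-pred (≤∧≢⇒< j≤1+n j≢1+n)) (f≡0 ∘ m≤n⇒m≤1+n))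
                                     (f≡0 ≤-refl (j≢1+n ∘ sym)))
                       (ℤP.+-identityʳ (f j))

*ₛ-distribˡ-+ₛ : ∀ f g h → (f *ₛ (g +ₛ h)) ≈ₛ ((f *ₛ g) +ₛ (f *ₛ h))
*ₛ-distribˡ-+ₛ f g h n = trans (Σ≤-cong n λ {i} _ → ℤP.*-distribˡ-+ (f i) (g (n ∸ i)) (h (n ∸ i))) (Σ≤-+ n _ _)

*ₛ-·ₛ : ∀ f c g → (f *ₛ (c ·ₛ g)) ≈ₛ (c ·ₛ (f *ₛ g))
*ₛ-·ₛ f c g n = trans (Σ≤-cong n λ {i} _ → ℤ*-x∙yz≈y∙xz (f i) c (g (n ∸ i))) (Σ≤-* n c _)

qPow-≢ : ∀ {e n} → e ≢ n → qPow e n ≡ 0ℤ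
qPow-≢ {e} {n} e≢n with e ℕ.≟ n
... | yes e≡n = contradiction e≡n e≢n
... | no _    = refl

qPow-≡ : ∀ e → qPow e e ≡ 1ℤ
qPow-≡ e with e ℕ.≟ e
... | yes _   = refl
... | no e≢e  = contradiction refl e≢e

*ₛ-qPow-≥ : ∀ f {e n} → e ≤ n → (f *ₛ qPow e) n ≡ f (n ∸ e)
*ₛ-qPow-≥ f {e} {n} e≤n = begin
  Σ≤ n (λ i → f i ℤ.* qPow e (n ∸ i))     ≡⟨ Σ≤-single n (m∸n≤m n e) off-diagonal ⟩
  f (n ∸ e) ℤ.* qPow e (n ∸ (n ∸ e))       ≡⟨ cong (λ j → f (n ∸ e) ℤ.* qPow e j) (m∸[m∸n]≡n e≤n) ⟩
  f (n ∸ e) ℤ.* qPow e e                   ≡⟨ cong (f (n ∸ e) ℤ.*_) (qPow-≡ e) ⟩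
  f (n ∸ e) ℤ.* 1ℤ                         ≡⟨ ℤP.*-identityʳ (f (n ∸ e)) ⟩
  f (n ∸ e)                                ∎
  where
  open ≡-Reasoning
  off-diagonal : ∀ {i} → i ≤ n → i ≢ n ∸ e → f i ℤ.* qPow e (n ∸ i) ≡ 0ℤ
  off-diagonal {i} i≤n i≢ =
    trans (cong (f i ℤ.*_) (qPow-≢ λ e≡ → i≢ (trans (sym (m∸[m∸n]≡n i≤n)) (cong (n ∸_) (sym e≡)))))
          (ℤP.*-zeroʳ (f i))

*ₛ-qPow-< : ∀ f {e n} → n < e → (f *ₛ qPow e) n ≡ 0ℤ
*ₛ-qPow-< f {e} {n} n<e = Σ≤-vanishing n λ {i} _ →
  trans (cong (f i ℤ.*_) (qPow-≢ λ e≡ → <⇒≱ n<e (subst (_≤ n) (sym e≡) (m∸n≤m n i)))) (ℤP.*-zeroʳ (f i))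

genP*qPow-tri : ∀ k → (genP *ₛ qPow (tri (suc k))) ≈ₛ (λ n → + pWithPartsUnder (suc k) n)
genP*qPow-tri k n with tri (suc k) ≤? n
... | yes T≤n = trans (*ₛ-qPow-≥ genP T≤n) (cong +_ (sym (begin
  pWithPartsUnder (suc k) n                                 ≡⟨ cong (pWithPartsUnder (suc k)) (m+[n∸m]≡n T≤n) ⟨
  pWithPartsUnder (suc k) (tri (suc k) + (n ∸ tri (suc k))) ≡⟨ pWithPartsUnder-tri+ k (n ∸ tri (suc k)) ⟩
  p (n ∸ tri (suc k))                                       ∎)))
  where open ≡-Reasoning
... | no T≰n  = trans (*ₛ-qPow-< genP (≰⇒> T≰n)) (cong +_ (sym (pWithPartsUnder-<tri k n (≰⇒> T≰n))))

genN-recurrence : ∀ k → (genN (suc k) +ₛ genN (suc (suc k))) ≈ₛ (genP *ₛ qPow (tri (suc k)))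
genN-recurrence k n = trans (cong +_ (N+N≡pWithPartsUnder k n)) (sym (genP*qPow-tri k n))

signedQPow : ℕ → ℕ → FPS
signedQPow ν τ = ((- (+ 1)) ^ τ) ·ₛ qPow (tri (ν + τ))

partialExpansion : ℕ → ℕ → FPS
partialExpansion ν m = (genP *ₛ Σₛ m (signedQPow ν)) +ₛ (((- (+ 1)) ^ (m + 1)) ·ₛ genN (ν + m + 1))

partialExpansion-zero : ∀ k → partialExpansion (suc k) 0 ≈ₛ genN (suc k)
partialExpansion-zero k n = begin
  (genP *ₛ Σₛ 0 (signedQPow (suc k))) n ℤ.+ (- (+ 1)) ^ 1 ℤ.* + N (suc k + 0 + 1) n
    ≡⟨ cong (ℤ._+ (- (+ 1)) ^ 1 ℤ.* + N (suc k + 0 + 1) n) (*ₛ-·ₛ genP 1ℤ (qPow (tri (suc k + 0))) n) ⟩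
  1ℤ ℤ.* (genP *ₛ qPow (tri (suc k + 0))) n ℤ.+ (- (+ 1)) ^ 1 ℤ.* + N (suc k + 0 + 1) n
    ≡⟨ cong₂ (λ i j → 1ℤ ℤ.* (genP *ₛ qPow (tri i)) n ℤ.+ (- (+ 1)) ^ 1 ℤ.* + N j n) (+-identityʳ (suc k)) ν+0+1≡ν+1 ⟩
  1ℤ ℤ.* (genP *ₛ qPow (tri (suc k))) n ℤ.+ (- (+ 1)) ^ 1 ℤ.* B
    ≡⟨ cong (λ c → 1ℤ ℤ.* c ℤ.+ (- (+ 1)) ^ 1 ℤ.* B) (genN-recurrence k n) ⟨
  1ℤ ℤ.* (A ℤ.+ B) ℤ.+ ((- (+ 1)) ℤ.* 1ℤ) ℤ.* B
    ≡⟨ cancel A B ⟩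
  A ∎
  where
  open ≡-Reasoning
  A = + N (suc k) n
  B = + N (suc (suc k)) n
  ν+0+1≡ν+1 : suc k + 0 + 1 ≡ suc (suc k)
  ν+0+1≡ν+1 = trans (+-comm (suc k + 0) 1) (cong suc (+-identityʳ (suc k)))
  cancel : ∀ A B → 1ℤ ℤ.* (A ℤ.+ B) ℤ.+ ((- (+ 1)) ℤ.* 1ℤ) ℤ.* B ≡ A
  cancel = ℤSolver.solve-∀

partialExpansion-suc : ∀ k m → partialExpansion (suc k) (suc m) ≈ₛ partialExpansion (suc k) m
partialExpansion-suc k m n = begin
  (genP *ₛ Σₛ (suc m) (signedQPow (suc k))) n ℤ.+ last
    ≡⟨ cong (ℤ._+ last) (*ₛ-distribˡ-+ₛ genP (Σₛ m (signedQPow (suc k))) (signedQPow (suc k) (suc m)) n) ⟩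
  (X ℤ.+ (genP *ₛ signedQPow (suc k) (suc m)) n) ℤ.+ last
    ≡⟨ cong (λ y → (X ℤ.+ y) ℤ.+ last) new-term ⟩
  (X ℤ.+ s ℤ.* (genP *ₛ qPow (tri (suc k + m + 1))) n) ℤ.+ last
    ≡⟨ cong₂ (λ c j → (X ℤ.+ s ℤ.* c) ℤ.+ ((- (+ 1)) ℤ.* s) ℤ.* + N j n) (genN-recurrence (k + m + 1) n) index ⟨
  (X ℤ.+ s ℤ.* (A ℤ.+ B)) ℤ.+ ((- (+ 1)) ℤ.* s) ℤ.* B
    ≡⟨ cancel X s A B ⟩
  X ℤ.+ s ℤ.* A ∎
  where
  open ≡-Reasoning
  X = (genP *ₛ Σₛ m (signedQPow (suc k))) n
  s = (- (+ 1)) ^ (m + 1)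
  A = + N (suc k + m + 1) n
  B = + N (suc (suc k + m + 1)) n
  last = ((- (+ 1)) ^ (suc m + 1)) ℤ.* + N (suc k + suc m + 1) n
  ν+1+m≡ν+m+1 : suc k + suc m ≡ suc k + m + 1
  ν+1+m≡ν+m+1 = cong suc (trans (+-suc k m) (sym (+-comm (k + m) 1)))
  index : suc (suc k + m + 1) ≡ suc k + suc m + 1
  index = sym (trans (cong (_+ 1) ν+1+m≡ν+m+1) (+-comm (suc k + m + 1) 1))
  new-term : (genP *ₛ signedQPow (suc k) (suc m)) n ≡ s ℤ.* (genP *ₛ qPow (tri (suc k + m + 1))) n
  new-term = trans (*ₛ-·ₛ genP ((- (+ 1)) ^ suc m) (qPow (tri (suc k + suc m))) n)
                   (cong₂ (λ e j → (- (+ 1)) ^ e ℤ.* (genP *ₛ qPow (tri j)) n) (+-comm 1 m) ν+1+m≡ν+m+1)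
  cancel : ∀ X s A B → (X ℤ.+ s ℤ.* (A ℤ.+ B)) ℤ.+ ((- (+ 1)) ℤ.* s) ℤ.* B ≡ X ℤ.+ s ℤ.* A
  cancel = ℤSolver.solve-∀

lemma2p1 : (ν m : ℕ) → 1 ≤ ν →
    genN ν ≈ₛ ((genP *ₛ Σₛ m (λ τ → ((- (+ 1)) ^ τ) ·ₛ qPow (tri (ν + τ))))
               +ₛ (((- (+ 1)) ^ (m + 1)) ·ₛ genN (ν + m + 1)))
lemma2p1 (suc k) zero    _   n = sym (partialExpansion-zero k n)
lemma2p1 (suc k) (suc m) 1≤ν n = trans (lemma2p1 (suc k) m 1≤ν n) (sym (partialExpansion-suc k m n))
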